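{- Let $G$ and $H$ be loopless graphs with vertex sets $\{u_1,\dots,u_n\}$ and $\{v_1,\dots,v_n\}$, let $e$ be an edge of $G$ with ends $u_{s_1}\ne u_{s_2}$ and $f$ an edge of $H$ with ends $v_{t_1}\ne v_{t_2}$, and let $\psi$ be an isomorphism from $G/e$ to $H/f$. Let $D_\psi$ be the digraph defined below. Then for any directed cycle $C$ of $D_\psi$: both $s_1$ and $s_2$ lie on $C$ if and only if both $t_1$ and $t_2$ lie on $C$; and if both $s_1,s_2$ lie on $C$, then $\psi(u^*)=v^*$ and $C$ contains both arcs $s_1\rightarrow t_j$ and $s_2\rightarrow t_{3-j}$ for some $j\in\{1,2\}$.
   Context: $G/e$ is the graph obtained from $G\backslash e$ by identifying the two ends of $e$; write $u^*$ for the vertex of $G/e$ formed from $u_{s_1},u_{s_2}$, so $V(G/e)=\{u_i:i\in[n]\setminus\{s_1,s_2\}\}\cup\{u^*\}$; similarly $v^*$ is the vertex of $H/f$ formed from $v_{t_1},v_{t_2}$. The digraph $D_\psi$ has vertex set $[n]=\{1,\dots,n\}$, and $i\rightarrow j$ is an arc if and only if one of the following holds: (a) $i\notin\{s_1,s_2\}$, $j\notin\{t_1,t_2\}$ and $\psi(u_i)=v_j$; (b) $i\in\{s_1,s_2\}$, $j\notin\{t_1,t_2\}$ and $\psi(u^*)=v_j$; (c) $i\notin\{s_1,s_2\}$, $j\in\{t_1,t_2\}$ and $\psi(u_i)=v^*$; (d) $i\in\{s_1,s_2\}$, $j\in\{t_1,t_2\}$ and $\psi(u^*)=v^*$. A directed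 cycle is a closed directed walk $\pi(1)\rightarrow\pi(2)\rightarrow\cdots\rightarrow\pi(k)\rightarrow\pi(1)$ with $\pi(1),\dots,\pi(k)$ distinct ($k\ge1$). -}

module Defs where

open import Data.Nat using (ℕ; suc)
open import Data.Fin using (Fin; zero; suc; inject₁; fromℕ; _≟_)
open import Data.Product using (Σ; ∃; _×_; _,_; proj₁; proj₂)
open import Data.Sum using (_⊎_)
open import Relation.Binary.PropositionalEquality using (_≡_; _≢_)
open import Relation.Nullary using (yes; no)
open import Function using (Injective)
open import Function.Bundles using (_⤖_; Bijection)

record Graph (V : Set) : Set₁ where
  field
    E    : Set
    ends : E → V × V
open Graph public

Loopless : {V : Set} → Graph V → Set
Loopless G = ∀ x → proj₁ (ends G x) ≢ proj₂ (ends G x)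

HasEnds : {V : Set} (G : Graph V) → E G → V → V → Set
HasEnds G x a b = (ends G x ≡ (a , b)) ⊎ (ends G x ≡ (b , a))

record Iso {V W : Set} (G : Graph V) (H : Graph W) : Set where
  field
    vmap : V ⤖ W
    emap : E G ⤖ E H
    incidence : ∀ x → HasEnds H (Bijection.to emap x)
                        (Bijection.to vmap (proj₁ (ends G x)))
                        (Bijection.to vmap (proj₂ (ends G x)))

-- Vertex set of G/e for G on {u_1..u_n} and e with ends u_s1, u_s2:
-- old vertices u_i (i ∉ {s1,s2}) and the new vertex u*.
data CVert (n : ℕ) (s₁ s₂ : Fin n) : Set where
  old  : (i : Fin n) → .(i ≢ s₁) → .(i ≢ s₂) → CVert n s₁ s₂
  star : CVert n s₁ s₂

cmap : {n : ℕ} (s₁ s₂ : Fin n) → Fin n → CVert n s₁ s₂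
cmap s₁ s₂ i with i ≟ s₁ | i ≟ s₂
... | yes _ | _     = star
... | no _  | yes _ = star
... | no p  | no q  = old i p q

-- G / e : delete e, identify its ends (loops may arise; they are kept).
contract : {n : ℕ} (G : Graph (Fin n)) (e : E G) (s₁ s₂ : Fin n) → Graph (CVert n s₁ s₂)
contract G e s₁ s₂ = record
  { E    = Σ (E G) (λ x → x ≢ e)
  ; ends = λ x → cmap s₁ s₂ (proj₁ (ends G (proj₁ x))) , cmap s₁ s₂ (proj₂ (ends G (proj₁ x)))
  }

data Arc {n : ℕ} {s₁ s₂ t₁ t₂ : Fin n} (ψ : CVert n s₁ s₂ → CVert n t₁ t₂)
         (i j : Fin n) : Set where
  arcA : .(p : i ≢ s₁) .(q : i ≢ s₂) .(p' : j ≢ t₁) .(q' : j ≢ t₂) →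
         ψ (old i p q) ≡ old j p' q' → Arc ψ i j
  arcB : (i ≡ s₁ ⊎ i ≡ s₂) → .(p' : j ≢ t₁) .(q' : j ≢ t₂) →
         ψ star ≡ old j p' q' → Arc ψ i j
  arcC : .(p : i ≢ s₁) .(q : i ≢ s₂) → (j ≡ t₁ ⊎ j ≡ t₂) →
         ψ (old i p q) ≡ star → Arc ψ i j
  arcD : (i ≡ s₁ ⊎ i ≡ s₂) → (j ≡ t₁ ⊎ j ≡ t₂) →
         ψ star ≡ star → Arc ψ i j

-- A directed cycle π(0) → π(1) → … → π(k) → π(0) with distinct vertices (length k+1 ≥ 1).
record DirCycle {n : ℕ} (A : Fin n → Fin n → Set) : Set where
  field
    k     : ℕ
    π     : Fin (suc k) → Fin n
    π-inj : Injective _≡_ _≡_ π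
    step  : ∀ (a : Fin k) → A (π (inject₁ a)) (π (suc a))
    close : A (π (fromℕ k)) (π zero)
open DirCycle public

OnCycle : {n : ℕ} {A : Fin n → Fin n → Set} → DirCycle A → Fin n → Set
OnCycle C v = ∃ λ a → π C a ≡ v

ArcOnCycle : {n : ℕ} {A : Fin n → Fin n → Set} → DirCycle A → Fin n → Fin n → Set
ArcOnCycle C i j =
  (∃ λ (a : Fin (k C)) → π C (inject₁ a) ≡ i × π C (suc a) ≡ j)
  ⊎ (π C (fromℕ (k C)) ≡ i × π C zero ≡ j)

-- Along a directed cycle every vertex has exactly one outgoing and one incoming cycle arc,
-- and distinct vertices have distinct cycle successors and predecessors. If ψ(u*) = v_j₀ is
-- an old vertex, every arc of D_ψ leaving s₁ or s₂ ends at j₀, so s₁ and s₂ cannot both lie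
-- on C; dually, by injectivity of ψ every arc entering t₁ or t₂ starts at the unique i with
-- ψ(u_i) = v*, so t₁ and t₂ cannot both lie on C. If ψ(u*) = v*, arcs leaving {s₁, s₂} end
-- in {t₁, t₂} and arcs entering {t₁, t₂} start in {s₁, s₂}, so the cycle successors of s₁
-- and s₂ are t₁ and t₂ in some order, and the cycle predecessors of t₁ and t₂ are s₁ and s₂.
module Submission where

open import Defs
open import Data.Nat using (ℕ)
open import Data.Fin using (Fin; zero; suc; inject₁)
open import Data.Fin.Properties using (suc-injective; inject₁-injective; fromℕ≢inject₁)
open import Data.Fin.Relation.Unary.Top using (view; ‵fromℕ; ‵inject₁)
open import Data.Product using (_×_; ∃; _,_)
open import Data.Sum using (_⊎_; inj₁; inj₂)
open import Data.Empty using (⊥; ⊥-elim)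
import Data.Empty.Irrelevant as Irrelevant
open import Relation.Nullary using (¬_)
open import Relation.Binary.PropositionalEquality using (_≡_; _≢_; refl; sym; trans; cong)
open import Function using (Injective; _∘_; mk⇔)
open import Function.Bundles using (_⇔_; Bijection)

module _ {n : ℕ} {A : Fin n → Fin n → Set} (C : DirCycle A) where

  arcOnCycle⇒arc : ∀ {i j} → ArcOnCycle C i j → A i j
  arcOnCycle⇒arc (inj₁ (a , refl , refl)) = step C a
  arcOnCycle⇒arc (inj₂ (refl , refl))     = close C

  arcOnCycle⇒source-onCycle : ∀ {i j} → ArcOnCycle C i j → OnCycle C i
  arcOnCycle⇒source-onCycle (inj₁ (a , p , _)) = inject₁ a , p
  arcOnCycle⇒source-onCycle (inj₂ (p , _))     = _ , p

  arcOnCycle⇒target-onCycle : ∀ {i j} → ArcOnCycle C i j → OnCycle C j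
  arcOnCycle⇒target-onCycle (inj₁ (a , _ , q)) = suc a , q
  arcOnCycle⇒target-onCycle (inj₂ (_ , q))     = zero , q

  onCycle⇒outgoing : ∀ {i} → OnCycle C i → ∃ λ j → ArcOnCycle C i j
  onCycle⇒outgoing (a , refl) with view a
  ... | ‵fromℕ     = _ , inj₂ (refl , refl)
  ... | ‵inject₁ b = _ , inj₁ (b , refl , refl)

  onCycle⇒incoming : ∀ {j} → OnCycle C j → ∃ λ i → ArcOnCycle C i j
  onCycle⇒incoming (zero , refl)  = _ , inj₂ (refl , refl)
  onCycle⇒incoming (suc b , refl) = _ , inj₁ (b , refl , refl)

  arcOnCycle-functional : ∀ {i j j′} → ArcOnCycle C i j → ArcOnCycle C i j′ → j ≡ j′
  arcOnCycle-functional (inj₁ (a , p , refl)) (inj₁ (b , q , refl)) =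
    cong (π C ∘ suc) (inject₁-injective (π-inj C (trans p (sym q))))
  arcOnCycle-functional (inj₁ (a , p , _)) (inj₂ (q , _)) =
    ⊥-elim (fromℕ≢inject₁ (π-inj C (trans q (sym p))))
  arcOnCycle-functional (inj₂ (p , _)) (inj₁ (b , q , _)) =
    ⊥-elim (fromℕ≢inject₁ (π-inj C (trans p (sym q))))
  arcOnCycle-functional (inj₂ (_ , refl)) (inj₂ (_ , refl)) = refl

  arcOnCycle-injective : ∀ {i i′ j} → ArcOnCycle C i j → ArcOnCycle C i′ j → i ≡ i′
  arcOnCycle-injective (inj₁ (a , refl , p)) (inj₁ (b , refl , q)) =
    cong (π C ∘ inject₁) (suc-injective (π-inj C (trans p (sym q))))
  arcOnCycle-injective (inj₁ (a , _ , p)) (inj₂ (_ , q)) with π-inj C (trans p (sym q))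
  ... | ()
  arcOnCycle-injective (inj₂ (_ , p)) (inj₁ (b , _ , q)) with π-inj C (trans p (sym q))
  ... | ()
  arcOnCycle-injective (inj₂ (refl , _)) (inj₂ (refl , _)) = refl

OneOf : {V : Set} → V → V → V → Set
OneOf x y v = v ≡ x ⊎ v ≡ y

oneOf-contradiction : {V : Set} {x y v : V} → OneOf x y v → .(v ≢ x) → .(v ≢ y) → ⊥
oneOf-contradiction (inj₁ v≡x) v≢x _ = Irrelevant.⊥-elim (v≢x v≡x)
oneOf-contradiction (inj₂ v≡y) _ v≢y = Irrelevant.⊥-elim (v≢y v≡y)

oneOf-distinct : {V : Set} {x y v w : V} → OneOf x y v → OneOf x y w → v ≢ w →
                 (v ≡ x × w ≡ y) ⊎ (v ≡ y × w ≡ x)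
oneOf-distinct (inj₁ v≡x) (inj₁ w≡x) v≢w = ⊥-elim (v≢w (trans v≡x (sym w≡x)))
oneOf-distinct (inj₁ v≡x) (inj₂ w≡y) _   = inj₁ (v≡x , w≡y)
oneOf-distinct (inj₂ v≡y) (inj₁ w≡x) _   = inj₂ (v≡y , w≡x)
oneOf-distinct (inj₂ v≡y) (inj₂ w≡y) v≢w = ⊥-elim (v≢w (trans v≡y (sym w≡y)))

module ArcsAtContractedEnds {n : ℕ} {s₁ s₂ t₁ t₂ : Fin n}
  (ψ : CVert n s₁ s₂ → CVert n t₁ t₂) (ψ-injective : Injective _≡_ _≡_ ψ) where

  arc-from-end⇒target : ∀ {i j j₀} .{p q} → ψ star ≡ old j₀ p q →
                        OneOf s₁ s₂ i → Arc ψ i j → j ≡ j₀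
  arc-from-end⇒target _ i∈s (arcA p q _ _ _) = ⊥-elim (oneOf-contradiction i∈s p q)
  arc-from-end⇒target _ i∈s (arcC p q _ _)   = ⊥-elim (oneOf-contradiction i∈s p q)
  arc-from-end⇒target ψ* _ (arcB _ _ _ ψ*′) with trans (sym ψ*′) ψ*
  ... | refl = refl
  arc-from-end⇒target ψ* _ (arcD _ _ ψ*′) with trans (sym ψ*′) ψ*
  ... | ()

  data MapsToStar (i : Fin n) : Set where
    mapsToStar : .(i≢s₁ : i ≢ s₁) .(i≢s₂ : i ≢ s₂) → ψ (old i i≢s₁ i≢s₂) ≡ star → MapsToStar i

  mapsToStar-unique : ∀ {i i′} → MapsToStar i → MapsToStar i′ → i ≡ i′
  mapsToStar-unique (mapsToStar _ _ ψi) (mapsToStar _ _ ψi′) with ψ-injective (trans ψi (sym ψi′))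
  ... | refl = refl

  arc-into-end⇒mapsToStar : ∀ {i j j₀} .{p q} → ψ star ≡ old j₀ p q →
                            OneOf t₁ t₂ j → Arc ψ i j → MapsToStar i
  arc-into-end⇒mapsToStar _ j∈t (arcA _ _ p q _) = ⊥-elim (oneOf-contradiction j∈t p q)
  arc-into-end⇒mapsToStar _ j∈t (arcB _ p q _)   = ⊥-elim (oneOf-contradiction j∈t p q)
  arc-into-end⇒mapsToStar _ _ (arcC p q _ ψi)    = mapsToStar p q ψi
  arc-into-end⇒mapsToStar ψ* _ (arcD _ _ ψ*′) with trans (sym ψ*′) ψ*
  ... | ()

  arc-from-end⇒into-end : ∀ {i j} → ψ star ≡ star → OneOf s₁ s₂ i → Arc ψ i j → OneOf t₁ t₂ j
  arc-from-end⇒into-end _ i∈s (arcA p q _ _ _) = ⊥-elim (oneOf-contradiction i∈s p q)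
  arc-from-end⇒into-end _ i∈s (arcC p q _ _)   = ⊥-elim (oneOf-contradiction i∈s p q)
  arc-from-end⇒into-end ψ* _ (arcB _ _ _ ψ*′) with trans (sym ψ*) ψ*′
  ... | ()
  arc-from-end⇒into-end _ _ (arcD _ j∈t _) = j∈t

  arc-into-end⇒from-end : ∀ {i j} → ψ star ≡ star → OneOf t₁ t₂ j → Arc ψ i j → OneOf s₁ s₂ i
  arc-into-end⇒from-end _ j∈t (arcA _ _ p q _) = ⊥-elim (oneOf-contradiction j∈t p q)
  arc-into-end⇒from-end _ j∈t (arcB _ p q _)   = ⊥-elim (oneOf-contradiction j∈t p q)
  arc-into-end⇒from-end ψ* _ (arcC _ _ _ ψi) with ψ-injective (trans ψi (sym ψ*))
  ... | ()
  arc-into-end⇒from-end _ _ (arcD i∈s _ _) = i∈s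

module EndsOnCycle {n : ℕ} {s₁ s₂ t₁ t₂ : Fin n}
  (ψ : CVert n s₁ s₂ → CVert n t₁ t₂) (ψ-injective : Injective _≡_ _≡_ ψ)
  (s₁≢s₂ : s₁ ≢ s₂) (t₁≢t₂ : t₁ ≢ t₂) (C : DirCycle (Arc ψ)) where

  open ArcsAtContractedEnds ψ ψ-injective

  BothOnCycle : Fin n → Fin n → Set
  BothOnCycle x y = OnCycle C x × OnCycle C y

  EndsMatched : Set
  EndsMatched = (ArcOnCycle C s₁ t₁ × ArcOnCycle C s₂ t₂)
              ⊎ (ArcOnCycle C s₁ t₂ × ArcOnCycle C s₂ t₁)

  star↦old⇒¬s-onCycle : ∀ {j₀} .{p q} → ψ star ≡ old j₀ p q → ¬ BothOnCycle s₁ s₂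
  star↦old⇒¬s-onCycle ψ* (s₁∈C , s₂∈C)
    with onCycle⇒outgoing C s₁∈C | onCycle⇒outgoing C s₂∈C
  ... | _ , s₁→j₁ | _ , s₂→j₂
    with arc-from-end⇒target ψ* (inj₁ refl) (arcOnCycle⇒arc C s₁→j₁)
       | arc-from-end⇒target ψ* (inj₂ refl) (arcOnCycle⇒arc C s₂→j₂)
  ... | refl | refl = s₁≢s₂ (arcOnCycle-injective C s₁→j₁ s₂→j₂)

  star↦old⇒¬t-onCycle : ∀ {j₀} .{p q} → ψ star ≡ old j₀ p q → ¬ BothOnCycle t₁ t₂
  star↦old⇒¬t-onCycle ψ* (t₁∈C , t₂∈C)
    with onCycle⇒incoming C t₁∈C | onCycle⇒incoming C t₂∈C
  ... | _ , i₁→t₁ | _ , i₂→t₂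
    with mapsToStar-unique (arc-into-end⇒mapsToStar ψ* (inj₁ refl) (arcOnCycle⇒arc C i₁→t₁))
                           (arc-into-end⇒mapsToStar ψ* (inj₂ refl) (arcOnCycle⇒arc C i₂→t₂))
  ... | refl = t₁≢t₂ (arcOnCycle-functional C i₁→t₁ i₂→t₂)

  s-onCycle⇒star↦star : BothOnCycle s₁ s₂ → ψ star ≡ star
  s-onCycle⇒star↦star s∈C with ψ star in ψ*
  ... | old _ _ _ = ⊥-elim (star↦old⇒¬s-onCycle ψ* s∈C)
  ... | star      = refl

  t-onCycle⇒star↦star : BothOnCycle t₁ t₂ → ψ star ≡ star
  t-onCycle⇒star↦star t∈C with ψ star in ψ*
  ... | old _ _ _ = ⊥-elim (star↦old⇒¬t-onCycle ψ* t∈C)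
  ... | star      = refl

  star↦star⇒endsMatched : ψ star ≡ star → BothOnCycle s₁ s₂ → EndsMatched
  star↦star⇒endsMatched ψ* (s₁∈C , s₂∈C)
    with onCycle⇒outgoing C s₁∈C | onCycle⇒outgoing C s₂∈C
  ... | _ , s₁→j₁ | _ , s₂→j₂
    with oneOf-distinct (arc-from-end⇒into-end ψ* (inj₁ refl) (arcOnCycle⇒arc C s₁→j₁))
                        (arc-from-end⇒into-end ψ* (inj₂ refl) (arcOnCycle⇒arc C s₂→j₂))
                        (λ { refl → s₁≢s₂ (arcOnCycle-injective C s₁→j₁ s₂→j₂) })
  ... | inj₁ (refl , refl) = inj₁ (s₁→j₁ , s₂→j₂)
  ... | inj₂ (refl , refl) = inj₂ (s₁→j₁ , s₂→j₂)

  endsMatched⇒t-onCycle : EndsMatched → BothOnCycle t₁ t₂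
  endsMatched⇒t-onCycle (inj₁ (s₁→t₁ , s₂→t₂)) =
    arcOnCycle⇒target-onCycle C s₁→t₁ , arcOnCycle⇒target-onCycle C s₂→t₂
  endsMatched⇒t-onCycle (inj₂ (s₁→t₂ , s₂→t₁)) =
    arcOnCycle⇒target-onCycle C s₂→t₁ , arcOnCycle⇒target-onCycle C s₁→t₂

  star↦star⇒s-onCycle : ψ star ≡ star → BothOnCycle t₁ t₂ → BothOnCycle s₁ s₂
  star↦star⇒s-onCycle ψ* (t₁∈C , t₂∈C)
    with onCycle⇒incoming C t₁∈C | onCycle⇒incoming C t₂∈C
  ... | _ , i₁→t₁ | _ , i₂→t₂
    with oneOf-distinct (arc-into-end⇒from-end ψ* (inj₁ refl) (arcOnCycle⇒arc C i₁→t₁))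
                        (arc-into-end⇒from-end ψ* (inj₂ refl) (arcOnCycle⇒arc C i₂→t₂))
                        (λ { refl → t₁≢t₂ (arcOnCycle-functional C i₁→t₁ i₂→t₂) })
  ... | inj₁ (refl , refl) = arcOnCycle⇒source-onCycle C i₁→t₁ , arcOnCycle⇒source-onCycle C i₂→t₂
  ... | inj₂ (refl , refl) = arcOnCycle⇒source-onCycle C i₂→t₂ , arcOnCycle⇒source-onCycle C i₁→t₁

proposition5p1 : (n : ℕ) (G H : Graph (Fin n)) → Loopless G → Loopless H →
    (e : E G) (s₁ s₂ : Fin n) → s₁ ≢ s₂ → HasEnds G e s₁ s₂ →
    (f : E H) (t₁ t₂ : Fin n) → t₁ ≢ t₂ → HasEnds H f t₁ t₂ →
    (ψ : Iso (contract G e s₁ s₂) (contract H f t₁ t₂)) →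
    (C : DirCycle (Arc (Bijection.to (Iso.vmap ψ)))) →
    ((OnCycle C s₁ × OnCycle C s₂) ⇔ (OnCycle C t₁ × OnCycle C t₂))
    × (OnCycle C s₁ × OnCycle C s₂ →
        (Bijection.to (Iso.vmap ψ) star ≡ star)
        × ((ArcOnCycle C s₁ t₁ × ArcOnCycle C s₂ t₂)
           ⊎ (ArcOnCycle C s₁ t₂ × ArcOnCycle C s₂ t₁)))
proposition5p1 _ _ _ _ _ _ _ _ s₁≢s₂ _ _ _ _ t₁≢t₂ _ ψ C =
  mk⇔ (λ s∈C → endsMatched⇒t-onCycle (star↦star⇒endsMatched (s-onCycle⇒star↦star s∈C) s∈C))
      (λ t∈C → star↦star⇒s-onCycle (t-onCycle⇒star↦star t∈C) t∈C)
  , λ s∈C → s-onCycle⇒star↦star s∈C , star↦star⇒endsMatched (s-onCycle⇒star↦star s∈C) s∈C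
  where
  open EndsOnCycle (Bijection.to (Iso.vmap ψ)) (Bijection.injective (Iso.vmap ψ)) s₁≢s₂ t₁≢t₂ C
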